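{- Let $k\ge 2$ be an integer and let $G$ be a connected graph of order $n$ containing a vertex $u$ of degree $d$. If $n\ge 2k+1$ and $k\le d\le n-k-1$, then $\eta_p(G)\le n-k$.
   Context: Graphs are finite, simple, undirected and connected. For $v\in V(G)$, $S\subseteq V(G)$: $d(v,S)=\min\{d(v,w):w\in S\}$. For a partition $\Pi=\{S_1,\dots,S_k\}$ of $V(G)$, $r(u|\Pi)=(d(u,S_1),\dots,d(u,S_k))$; $\Pi$ is resolving if $r(u|\Pi)\ne r(v|\Pi)$ for all distinct $u,v$, and dominating if each vertex $v$ has $d(v,S_j)=1$ for some $j$. $\eta_p(G)$ is the minimum cardinality of a partition that is both resolving and dominating. -}

module Defs where

open import Data.Nat using (ℕ; zero; suc; _≤_; _<_)
open import Data.Bool using (Bool; true; false)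
open import Data.Fin using (Fin)
open import Data.Fin.Subset using (Subset; ∣_∣)
open import Data.Vec using (tabulate)
open import Data.Product using (Σ; ∃; _×_; _,_)
open import Relation.Binary.PropositionalEquality using (_≡_; _≢_)
open import Relation.Nullary using (¬_)

record Graph (n : ℕ) : Set where
  field
    adj       : Fin n → Fin n → Bool
    adj-sym   : ∀ u v → adj u v ≡ adj v u
    adj-irrefl : ∀ v → adj v v ≡ false

open Graph public

Adj : ∀ {n} → Graph n → Fin n → Fin n → Set
Adj G u v = adj G u v ≡ true

degree : ∀ {n} → Graph n → Fin n → ℕ
degree {n} G u = ∣ tabulate (adj G u) ∣

data Walk {n} (G : Graph n) : Fin n → Fin n → ℕ → Set where
  here : ∀ {v} → Walk G v v zero
  step : ∀ {u w v m} → Adj G u w → Walk G w v m → Walk G u v (suc m)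

Connected : ∀ {n} → Graph n → Set
Connected G = ∀ u v → ∃ λ m → Walk G u v m

-- A vertex subset S given as a predicate; d(v,S) = m means: some w ∈ S is
-- reached from v by a walk of length m, and no w ∈ S is reached by a shorter walk.
-- (So m = min { d(v,w) : w ∈ S }.)
SetDist : ∀ {n} → Graph n → Fin n → (Fin n → Set) → ℕ → Set
SetDist G v S m =
  (∃ λ w → S w × Walk G v w m) ×
  (∀ w m' → S w → Walk G v w m' → m ≤ m')

-- A partition of V(G) into k (nonempty) classes, given by a class map
-- f : Fin n → Fin k that is surjective; class j is S_j = { v | f v ≡ j }.
Class : ∀ {n k} → (Fin n → Fin k) → Fin k → Fin n → Set
Class f j v = f v ≡ j

IsPartition : ∀ {n k} → (Fin n → Fin k) → Set
IsPartition {n} {k} f = ∀ (j : Fin k) → ∃ λ v → f v ≡ j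

-- Resolving: distinct vertices have distinct representations r(·|Π),
-- i.e. they differ in some coordinate d(·,S_j).
Resolving : ∀ {n k} → Graph n → (Fin n → Fin k) → Set
Resolving {n} {k} G f =
  ∀ (u v : Fin n) → u ≢ v →
  Σ (Fin k) λ j → Σ ℕ λ a → Σ ℕ λ b →
    SetDist G u (Class f j) a × SetDist G v (Class f j) b × a ≢ b

Dominating : ∀ {n k} → Graph n → (Fin n → Fin k) → Set
Dominating {n} {k} G f = ∀ (v : Fin n) → Σ (Fin k) λ j → SetDist G v (Class f j) 1

IsResDomPartition : ∀ {n} → Graph n → (k : ℕ) → (Fin n → Fin k) → Set
IsResDomPartition G k f = IsPartition f × Resolving G f × Dominating G f

-- η_p(G) ≤ m  (η_p is the minimum cardinality of such a partition)
EtaP≤ : ∀ {n} → Graph n → ℕ → Set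
EtaP≤ {n} G m = Σ ℕ λ k → k ≤ m × Σ (Fin n → Fin k) λ f → IsResDomPartition G k f

module Submission where

-- Take k disjoint pairs of vertices, merge each pair into one class and
-- keep every other vertex as a singleton: n − k classes.  Vertices of different
-- classes are distinguished by their own class (distance 0), singletons are
-- dominated by any neighbour, so it suffices that every paired vertex has a
-- neighbour outside its pair, and that in each pair {a, b} one vertex, say a,
-- has such a neighbour x whose class b does not touch (d(a,[x]) = 1 ≠ d(b,[x])).
-- The pairs are built around u.  Greedily choose k − 1 pairs (y, z) with
-- y ∈ N(u), z ∉ N[u] and z having a neighbour other than y; all of them are
-- split by the class of u.  Then fresh yₖ ∈ N(u) and zₖ ∉ N[u] either form a
-- k-th such pair, or zₖ is a pendant vertex at yₖ, and then {u, zₖ} is the k-th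
-- pair, split by y₁.  The degree bounds give room for the choices (pigeonhole).

open import Defs
open import Data.Nat using (ℕ; _≤_; _+_; _*_; _∸_)
open import Data.Fin using (Fin)
open import Relation.Binary.PropositionalEquality using (_≡_)

open import Data.Nat using (zero; suc; _<_; z≤n; s≤s; s≤s⁻¹)
open import Data.Nat.Properties
  using (≤-refl; ≤-trans; +-suc; +-identityʳ; ≮⇒≥; m≤n⇒m<n∨m≡n; m≤n⇒m≤1+n; ≤-<-trans; <-≤-trans; <-trans; n<1+n; n≤1+n; m+[n∸m]≡n; +-comm; m+n≤o⇒m≤o∸n; m≤o∸n⇒m+n≤o; ∸-+-assoc; +-monoˡ-≤; m≤m+n; m+n≤o⇒m≤o)
open import Data.Bool using (true)
import Data.Bool.Properties as Bool
open import Data.Fin using (zero; suc; punchIn; punchOut; cast)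
import Data.Fin.Properties as Fin
open import Data.Product using (Σ; ∃; _×_; _,_; proj₁; proj₂)
open import Data.Sum using (_⊎_; inj₁; inj₂)
import Data.Sum as Sum
open import Data.Unit using (⊤; tt)
open import Data.List using (List; []; _∷_; length)
open import Data.List.Membership.Propositional using (_∈_; _∉_)
open import Data.List.Relation.Unary.Any using (here; there)
import Data.List.Relation.Unary.Any as Any
open import Data.List.Relation.Unary.All using (All; []; _∷_)
open import Data.Product.Properties using () renaming (≡-dec to ×-≡-dec)
open import Data.Empty using (⊥-elim)
open import Function using (_∘_; case_of_)
open import Relation.Binary.PropositionalEquality using (_≢_; refl; sym; trans; cong; subst; module ≡-Reasoning)
open import Relation.Nullary using (¬_; Dec; yes; no)
open import Relation.Nullary.Decidable using (_×-dec_; _⊎-dec_; ¬?; decidable-stable)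
open import Relation.Unary using (Decidable)

leastWitness : {P : ℕ → Set} → (∀ i → Dec (P i)) → ∀ {m} → P m →
               ∃ λ i → P i × ∀ j → P j → i ≤ j
leastWitness {P} P? {m} p = finish (search m 0 (subst P (sym (+-identityʳ m)) p) λ _ ())
  where
  -- the invariant: P fails below i, and P (fuel + i) holds
  search : ∀ fuel i → P (fuel + i) → (∀ j → j < i → ¬ P j) →
           ∃ λ i → P i × ∀ j → j < i → ¬ P j
  search zero       i p below = i , p , below
  search (suc fuel) i p below with P? i
  ... | yes pᵢ = i , pᵢ , below
  ... | no ¬pᵢ = search fuel (suc i) (subst P (sym (+-suc fuel i)) p) below′
    where
    below′ : ∀ j → j < suc i → ¬ P j
    below′ j j<1+i with m≤n⇒m<n∨m≡n (s≤s⁻¹ j<1+i)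
    ... | inj₁ j<i  = below j j<i
    ... | inj₂ refl = ¬pᵢ
  finish : (∃ λ i → P i × ∀ j → j < i → ¬ P j) → ∃ λ i → P i × ∀ j → P j → i ≤ j
  finish (i , pᵢ , below) = i , pᵢ , λ j pⱼ → ≮⇒≥ (λ j<i → below j j<i pⱼ)

anotherElement : ∀ {n} → 2 ≤ n → (v : Fin n) → ∃ λ w → v ≢ w
anotherElement {suc (suc _)} _ zero    = suc zero , λ ()
anotherElement {suc (suc _)} _ (suc v) = zero , λ ()
anotherElement {suc zero} (s≤s ()) zero

module _ {n : ℕ} (G : Graph n) where

  Adj-sym : ∀ {a b} → Adj G a b → Adj G b a
  Adj-sym {a} {b} e = trans (adj-sym G b a) e

  Adj-irrefl : ∀ {a} → ¬ Adj G a a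
  Adj-irrefl {a} e = case trans (sym e) (adj-irrefl G a) of λ ()

  Adj? : ∀ a b → Dec (Adj G a b)
  Adj? a b = adj G a b Bool.≟ true

  neighbour : Connected G → 2 ≤ n → ∀ v → ∃ λ x → Adj G v x
  neighbour conn 2≤n v with anotherElement 2≤n v
  ... | w , v≢w with conn v w
  ...   | zero  , here          = ⊥-elim (v≢w refl)
  ...   | suc _ , step {w = x} a _ = x , a

  ReachesIn : (Fin n → Set) → Fin n → ℕ → Set
  ReachesIn S v m = ∃ λ w → S w × Walk G v w m

  reachesIn? : {S : Fin n → Set} → Decidable S → ∀ v m → Dec (ReachesIn S v m)
  reachesIn? S? v zero with S? v
  ... | yes s = yes (v , s , here)
  ... | no ¬s = no λ { (_ , s , here) → ¬s s }
  reachesIn? S? v (suc m) with Fin.any? (λ x → Adj? v x ×-dec reachesIn? S? x m)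
  ... | yes (x , a , (w , s , walk)) = yes (w , s , step a walk)
  ... | no ∄x = no λ { (w , s , step {w = x} a walk) → ∄x (x , a , (w , s , walk)) }

  distance : {S : Fin n → Set} → Decidable S → ∀ v {m} → ReachesIn S v m →
             ∃ λ d → SetDist G v S d
  distance S? v r with leastWitness (reachesIn? S? v) r
  ... | d , reach , least = d , reach , λ w m s walk → least m (w , s , walk)

module _ {n k : ℕ} (G : Graph n) (f : Fin n → Fin k) where

  classDistance : Connected G → IsPartition f → ∀ v j → ∃ λ d → SetDist G v (Class f j) d
  classDistance conn onto v j with onto j
  ... | w , fw≡j with conn v w
  ...   | _ , walk = distance G (λ x → f x Fin.≟ j) v (w , fw≡j , walk)

  ownClass : ∀ v → SetDist G v (Class f (f v)) 0
  ownClass v = (v , refl , here) , λ _ _ _ _ → z≤n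

  neighbourClass : ∀ {v x} → Adj G v x → f x ≢ f v → SetDist G v (Class f (f x)) 1
  neighbourClass {v} {x} a fx≢fv = (x , refl , step a here) , atLeastOne
    where
    atLeastOne : ∀ w m → Class f (f x) w → Walk G v w m → 1 ≤ m
    atLeastOne _ zero    fv≡fx here = ⊥-elim (fx≢fv (sym fv≡fx))
    atLeastOne _ (suc _) _     _    = s≤s z≤n

  Distinguished : Fin n → Fin n → Set
  Distinguished u v = Σ (Fin k) λ j → Σ ℕ λ a → Σ ℕ λ b →
    SetDist G u (Class f j) a × SetDist G v (Class f j) b × a ≢ b

  distinguished-sym : ∀ {u v} → Distinguished u v → Distinguished v u
  distinguished-sym (j , a , b , du , dv , a≢b) = j , b , a , dv , du , a≢b ∘ sym

  Separates : Fin n → Fin n → Set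
  Separates a b = ∃ λ x → Adj G a x × f x ≢ f a × ∀ y → f y ≡ f x → ¬ Adj G b y

  module _ (conn : Connected G) (onto : IsPartition f) where

    -- vertices of different classes are told apart by the class of the first
    differentClasses : ∀ {u v} → f u ≢ f v → Distinguished u v
    differentClasses {u} {v} fu≢fv with classDistance conn onto v (f u)
    ... | zero  , ((_ , fw≡fu , here) , _) = ⊥-elim (fu≢fv (sym fw≡fu))
    ... | suc b , dv = f u , 0 , suc b , ownClass u , dv , λ ()

    -- a separating neighbour gives distance 1 for a but not for b
    separated : ∀ {a b} → Separates a b → Distinguished a b
    separated {a} {b} (x , ax , fx≢fa , untouched) with classDistance conn onto b (f x)
    ... | d , db@((y , fy≡fx , walk) , _) =
      f x , 1 , d , neighbourClass ax fx≢fa , db , notOne walk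
      where
      notOne : ∀ {m} → Walk G b y m → 1 ≢ m
      notOne (step by here) refl = untouched y fy≡fx by

    resolvingCriterion : (∀ u v → u ≢ v → f u ≡ f v → Separates u v ⊎ Separates v u) →
                         Resolving G f
    resolvingCriterion sep u v u≢v with f u Fin.≟ f v
    ... | no fu≢fv = differentClasses fu≢fv
    ... | yes fu≡fv with sep u v u≢v fu≡fv
    ...   | inj₁ s = separated s
    ...   | inj₂ s = distinguished-sym (separated s)

  dominatingCriterion : (∀ v → ∃ λ x → Adj G v x × f x ≢ f v) → Dominating G f
  dominatingCriterion nbr v with nbr v
  ... | x , a , fx≢fv = f x , neighbourClass a fx≢fv

-- Identifying two points i ≢ j of Fin (suc m): a surjection onto Fin m whose
-- only non-trivial fibre is {i, j}.  (j is first redirected to i, then removed.)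
identify : ∀ {m} (i j : Fin (suc m)) → i ≢ j →
  Σ (Fin (suc m) → Fin m) λ g → (∀ y → ∃ λ x → g x ≡ y) ×
    (∀ x x′ → g x ≡ g x′ → x ≡ x′ ⊎ (x ≡ i × x′ ≡ j) ⊎ (x ≡ j × x′ ≡ i))
identify {m} i j i≢j = g , onto , fibres
  where
  redirect : ∀ x → Σ (Fin (suc m)) λ r → r ≢ j × ((x ≡ j × r ≡ i) ⊎ r ≡ x)
  redirect x with x Fin.≟ j
  ... | yes x≡j = i , i≢j , inj₁ (x≡j , refl)
  ... | no  x≢j = x , x≢j , inj₂ refl

  g : Fin (suc m) → Fin m
  g x = punchOut (proj₁ (proj₂ (redirect x)) ∘ sym)

  fixes : ∀ x → x ≢ j → proj₁ (redirect x) ≡ x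
  fixes x x≢j with redirect x
  ... | _ , _ , inj₁ (x≡j , _) = ⊥-elim (x≢j x≡j)
  ... | _ , _ , inj₂ r≡x       = r≡x

  onto : ∀ y → ∃ λ x → g x ≡ y
  onto y = punchIn j y ,
    trans (Fin.punchOut-cong j (fixes (punchIn j y) (Fin.punchInᵢ≢i j y))) (Fin.punchOut-punchIn j)

  fibres : ∀ x x′ → g x ≡ g x′ → x ≡ x′ ⊎ (x ≡ i × x′ ≡ j) ⊎ (x ≡ j × x′ ≡ i)
  fibres x x′ e with redirect x | redirect x′
  ... | r , r≢j , spec | r′ , r′≢j , spec′ =
    cases spec spec′ (Fin.punchOut-injective (r≢j ∘ sym) (r′≢j ∘ sym) e)
    where
    cases : (x ≡ j × r ≡ i) ⊎ r ≡ x → (x′ ≡ j × r′ ≡ i) ⊎ r′ ≡ x′ → r ≡ r′ →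
            x ≡ x′ ⊎ (x ≡ i × x′ ≡ j) ⊎ (x ≡ j × x′ ≡ i)
    cases (inj₁ (x≡j , _))   (inj₁ (x′≡j , _))   _    = inj₁ (trans x≡j (sym x′≡j))
    cases (inj₂ r≡x)         (inj₂ r′≡x′)        r≡r′ = inj₁ (trans (sym r≡x) (trans r≡r′ r′≡x′))
    cases (inj₁ (x≡j , r≡i)) (inj₂ r′≡x′)        r≡r′ = inj₂ (inj₂ (x≡j , trans (sym r′≡x′) (trans (sym r≡r′) r≡i)))
    cases (inj₂ r≡x)         (inj₁ (x′≡j , r′≡i)) r≡r′ = inj₂ (inj₁ (trans (sym r≡x) (trans r≡r′ r′≡i) , x′≡j))

module _ {n : ℕ} where

  Pair : Set
  Pair = Fin n × Fin n

  Mate : List Pair → Fin n → Fin n → Set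
  Mate Ps v w = (v , w) ∈ Ps ⊎ (w , v) ∈ Ps

  mate-sym : ∀ {Ps v w} → Mate Ps v w → Mate Ps w v
  mate-sym = Sum.swap

  Avoids : Fin n → List Pair → Set
  Avoids x = All λ p → x ≢ proj₁ p × x ≢ proj₂ p

  Disjoint : List Pair → Set
  Disjoint []             = ⊤
  Disjoint ((a , b) ∷ Ps) = a ≢ b × Avoids a Ps × Avoids b Ps × Disjoint Ps

  avoids⇒unmated : ∀ {x w Ps} → Avoids x Ps → ¬ Mate Ps x w
  avoids⇒unmated ((x≢a , _) ∷ _)  (inj₁ (here refl)) = x≢a refl
  avoids⇒unmated ((_ , x≢b) ∷ _)  (inj₂ (here refl)) = x≢b refl
  avoids⇒unmated (_ ∷ avoids)     (inj₁ (there m))   = avoids⇒unmated avoids (inj₁ m)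
  avoids⇒unmated (_ ∷ avoids)     (inj₂ (there m))   = avoids⇒unmated avoids (inj₂ m)

  mate-cons : ∀ {a b Ps v w} → Mate ((a , b) ∷ Ps) v w →
              (v ≡ a × w ≡ b) ⊎ (v ≡ b × w ≡ a) ⊎ Mate Ps v w
  mate-cons (inj₁ (here refl)) = inj₁ (refl , refl)
  mate-cons (inj₂ (here refl)) = inj₂ (inj₁ (refl , refl))
  mate-cons (inj₁ (there m))   = inj₂ (inj₂ (inj₁ m))
  mate-cons (inj₂ (there m))   = inj₂ (inj₂ (inj₂ m))

  mate-unique : ∀ {Ps v w w′} → Disjoint Ps → Mate Ps v w → Mate Ps v w′ → w ≡ w′
  mate-unique {[]} _ (inj₁ ()) _
  mate-unique {[]} _ (inj₂ ()) _
  mate-unique {(a , b) ∷ Ps} (a≢b , avoidsA , avoidsB , disjoint) m m′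
    with mate-cons m | mate-cons m′
  ... | inj₁ (_ , w≡b)               | inj₁ (_ , w′≡b)               = trans w≡b (sym w′≡b)
  ... | inj₂ (inj₁ (_ , w≡a))        | inj₂ (inj₁ (_ , w′≡a))        = trans w≡a (sym w′≡a)
  ... | inj₂ (inj₂ m₀)               | inj₂ (inj₂ m₀′)               = mate-unique disjoint m₀ m₀′
  ... | inj₁ (v≡a , _)               | inj₂ (inj₁ (v≡b , _))         = ⊥-elim (a≢b (trans (sym v≡a) v≡b))
  ... | inj₂ (inj₁ (v≡b , _))        | inj₁ (v≡a , _)                = ⊥-elim (a≢b (trans (sym v≡a) v≡b))
  ... | inj₁ (refl , _)              | inj₂ (inj₂ m₀′)               = ⊥-elim (avoids⇒unmated avoidsA m₀′)
  ... | inj₂ (inj₁ (refl , _))       | inj₂ (inj₂ m₀′)               = ⊥-elim (avoids⇒unmated avoidsB m₀′)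
  ... | inj₂ (inj₂ m₀)               | inj₁ (refl , _)               = ⊥-elim (avoids⇒unmated avoidsA m₀)
  ... | inj₂ (inj₂ m₀)               | inj₂ (inj₁ (refl , _))        = ⊥-elim (avoids⇒unmated avoidsB m₀)

  mate? : ∀ Ps v w → Dec (Mate Ps v w)
  mate? Ps v w = (v , w) ∈? Ps ⊎-dec (w , v) ∈? Ps
    where open import Data.List.Membership.DecPropositional (×-≡-dec Fin._≟_ Fin._≟_) using (_∈?_)

  Merges : ∀ {m} → (Fin n → Fin m) → List Pair → Set
  Merges f Ps = ∀ v w → f v ≡ f w → v ≡ w ⊎ Mate Ps v w

  alone : ∀ {m} {f : Fin n → Fin m} {Ps x} → Merges f Ps → Avoids x Ps → ∀ {v} → f x ≡ f v → x ≡ v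
  alone merges avoids {v} fx≡fv with merges _ v fx≡fv
  ... | inj₁ x≡v = x≡v
  ... | inj₂ mate = ⊥-elim (avoids⇒unmated avoids mate)

  mergePairs : (Ps : List Pair) → Disjoint Ps → ∀ m → n ≡ length Ps + m →
               Σ (Fin n → Fin m) λ f → IsPartition f × Merges f Ps
  mergePairs [] _ m n≡m = cast n≡m , onto , injective
    where
    onto : IsPartition (cast n≡m)
    onto j = cast (sym n≡m) j , Fin.cast-involutive n≡m (sym n≡m) j
    injective : Merges (cast n≡m) []
    injective v w e = inj₁ (begin
      v                          ≡⟨ Fin.cast-involutive (sym n≡m) n≡m v ⟨
      cast (sym n≡m) (cast n≡m v) ≡⟨ cong (cast (sym n≡m)) e ⟩
      cast (sym n≡m) (cast n≡m w) ≡⟨ Fin.cast-involutive (sym n≡m) n≡m w ⟩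
      w                          ∎)
      where open ≡-Reasoning
  mergePairs ((a , b) ∷ Ps) (a≢b , avoidsA , avoidsB , disjoint) m n≡ with
    mergePairs Ps disjoint (suc m) (trans n≡ (sym (+-suc (length Ps) m)))
  ... | f , onto , merges with identify (f a) (f b) (a≢b ∘ alone merges avoidsA)
  ...   | g , g-onto , g-fibres = g ∘ f , onto′ , merges′
    where
    onto′ : IsPartition (g ∘ f)
    onto′ j with g-onto j
    ... | i , gi≡j with onto i
    ...   | v , refl = v , gi≡j
    extend : ∀ {v w} → v ≡ w ⊎ Mate Ps v w → v ≡ w ⊎ Mate ((a , b) ∷ Ps) v w
    extend = Sum.map₂ (Sum.map there there)
    merges′ : Merges (g ∘ f) ((a , b) ∷ Ps)
    merges′ v w e with g-fibres (f v) (f w) e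
    ... | inj₁ fv≡fw = extend (merges v w fv≡fw)
    ... | inj₂ (inj₁ (fv≡fa , fw≡fb))
      rewrite alone merges avoidsA (sym fv≡fa) | alone merges avoidsB (sym fw≡fb) = inj₂ (inj₁ (here refl))
    ... | inj₂ (inj₂ (fv≡fb , fw≡fa))
      rewrite alone merges avoidsB (sym fv≡fb) | alone merges avoidsA (sym fw≡fa) = inj₂ (inj₂ (here refl))

module _ {n : ℕ} (G : Graph n) where

  UnmatedNeighbour : List Pair → Fin n → Set
  UnmatedNeighbour Ps v = ∃ λ x → Adj G v x × ¬ Mate Ps v x

  Splits : List Pair → Fin n → Fin n → Set
  Splits Ps a b = ∃ λ x → Adj G a x × ¬ Mate Ps a x × ¬ Adj G b x × ∀ y → Mate Ps x y → ¬ Adj G b y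

  record WellMerged (Ps : List Pair) (a b : Fin n) : Set where
    field
      dominated-a : UnmatedNeighbour Ps a
      dominated-b : UnmatedNeighbour Ps b
      split       : Splits Ps a b ⊎ Splits Ps b a

  module _ {m} {f : Fin n → Fin m} {Ps : List Pair} (merges : Merges f Ps) where

    otherClass : ∀ {v x} → Adj G v x → ¬ Mate Ps v x → f x ≢ f v
    otherClass vx unmated fx≡fv with merges _ _ fx≡fv
    ... | inj₁ refl = Adj-irrefl G vx
    ... | inj₂ mate = unmated (mate-sym mate)

    splits⇒separates : ∀ {a b} → Splits Ps a b → Separates G f a b
    splits⇒separates (x , ax , unmated , ¬bx , ¬bx′) =
      x , ax , otherClass ax unmated , untouched
      where
      untouched : ∀ y → f y ≡ f x → ¬ Adj G _ y
      untouched y fy≡fx with merges y x fy≡fx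
      ... | inj₁ refl = ¬bx
      ... | inj₂ mate = ¬bx′ y (mate-sym mate)

  mergedPartition : Connected G → 2 ≤ n → (Ps : List Pair) → Disjoint Ps →
                    ∀ m → n ≡ length Ps + m →
                    (∀ {a b} → (a , b) ∈ Ps → WellMerged Ps a b) →
                    Σ (Fin n → Fin m) (IsResDomPartition G m)
  mergedPartition conn 2≤n Ps disjoint m n≡ wellMerged
    with mergePairs Ps disjoint m n≡
  ... | f , onto , merges =
    f , onto , resolvingCriterion G f conn onto separation , dominatingCriterion G f domination
    where
    open WellMerged

    separation : ∀ u v → u ≢ v → f u ≡ f v → Separates G f u v ⊎ Separates G f v u
    separation u v u≢v fu≡fv with merges u v fu≡fv
    ... | inj₁ u≡v        = ⊥-elim (u≢v u≡v)
    ... | inj₂ (inj₁ uv)  = Sum.map (splits⇒separates merges) (splits⇒separates merges) (split (wellMerged uv))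
    ... | inj₂ (inj₂ vu)  = Sum.swap (Sum.map (splits⇒separates merges) (splits⇒separates merges) (split (wellMerged vu)))

    dominated : ∀ v → UnmatedNeighbour Ps v
    dominated v with neighbour G conn 2≤n v
    ... | x , vx with mate? Ps v x
    ...   | no unmated        = x , vx , unmated
    ...   | yes (inj₁ vx∈Ps) = dominated-a (wellMerged vx∈Ps)
    ...   | yes (inj₂ xv∈Ps) = dominated-b (wellMerged xv∈Ps)

    domination : ∀ v → ∃ λ x → Adj G v x × f x ≢ f v
    domination v with dominated v
    ... | x , vx , unmated = x , vx , otherClass merges vx unmated

module _ where
  open import Data.Fin.Subset as Subset using (Subset; inside; outside)
  open import Data.Vec using (_∷_; here; there)

  predecessors : ∀ {n} → List (Fin (suc n)) → List (Fin n)
  predecessors []           = []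
  predecessors (zero  ∷ xs) = predecessors xs
  predecessors (suc y ∷ xs) = y ∷ predecessors xs

  predecessors-length : ∀ {n} (xs : List (Fin (suc n))) → length (predecessors xs) ≤ length xs
  predecessors-length []           = z≤n
  predecessors-length (zero  ∷ xs) = m≤n⇒m≤1+n (predecessors-length xs)
  predecessors-length (suc _ ∷ xs) = s≤s (predecessors-length xs)

  predecessors-shorter : ∀ {n} (xs : List (Fin (suc n))) → zero ∈ xs →
                         length (predecessors xs) < length xs
  predecessors-shorter (zero  ∷ xs) _           = s≤s (predecessors-length xs)
  predecessors-shorter (suc _ ∷ xs) (there z∈)  = s≤s (predecessors-shorter xs z∈)

  predecessors-∈ : ∀ {n} {y : Fin n} (xs : List (Fin (suc n))) → suc y ∈ xs → y ∈ predecessors xs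
  predecessors-∈ (zero  ∷ xs) (there m)   = predecessors-∈ xs m
  predecessors-∈ (suc _ ∷ xs) (here refl) = here refl
  predecessors-∈ (suc _ ∷ xs) (there m)   = there (predecessors-∈ xs m)

  liftMissed : ∀ {n s} {p : Subset n} (xs : List (Fin (suc n))) →
               (∃ λ y → y Subset.∈ p × y ∉ predecessors xs) → ∃ λ x → x Subset.∈ (s ∷ p) × x ∉ xs
  liftMissed xs (y , y∈p , y∉) = suc y , there y∈p , y∉ ∘ predecessors-∈ xs

  pigeonhole : ∀ {n} (p : Subset n) (xs : List (Fin n)) → length xs < Subset.∣ p ∣ →
               ∃ λ x → x Subset.∈ p × x ∉ xs
  pigeonhole (outside ∷ p) xs lt =
    liftMissed xs (pigeonhole p (predecessors xs) (≤-<-trans (predecessors-length xs) lt))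
  pigeonhole (inside ∷ p) xs lt with Any.any? (zero Fin.≟_) xs
  ... | no 0∉xs  = zero , here , 0∉xs
  ... | yes 0∈xs =
    liftMissed xs (pigeonhole p (predecessors xs) (<-≤-trans (predecessors-shorter xs 0∈xs) (s≤s⁻¹ lt)))

module Anchoring {n : ℕ} (G : Graph n) (c : Fin n) where
  open import Data.Fin.Subset as Subset using (Subset; ∁)
  open import Data.Fin.Subset.Properties using (x∈∁p⇒x∉p; ∣p∣≤n)
  open import Data.Vec using (tabulate)
  open import Data.Vec.Properties using (lookup∘tabulate; []=⇒lookup; lookup⇒[]=)
  open import Data.List using (map)
  open import Data.List.Properties using (length-map)
  open import Data.List.Membership.Propositional.Properties using (∈-map⁺)
  import Data.List.Relation.Unary.All as All

  record Anchored (p : Pair) : Set where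
    constructor anchored
    field
      centre-y  : Adj G c (proj₁ p)
      ¬centre-z : ¬ Adj G c (proj₂ p)
      z≢c       : proj₂ p ≢ c
      escape    : ∃ λ s → Adj G (proj₂ p) s × s ≢ proj₁ p

  nbhd : Subset n
  nbhd = tabulate (adj G c)

  ∈nbhd⇒Adj : ∀ {x} → x Subset.∈ nbhd → Adj G c x
  ∈nbhd⇒Adj {x} x∈ = trans (sym (lookup∘tabulate (adj G c) x)) ([]=⇒lookup x∈)

  ∈∁nbhd⇒¬Adj : ∀ {x} → x Subset.∈ ∁ nbhd → ¬ Adj G c x
  ∈∁nbhd⇒¬Adj {x} x∈ cx = x∈∁p⇒x∉p x∈ (lookup⇒[]= x nbhd (trans (lookup∘tabulate (adj G c) x) cx))

  centre-sides : ∀ {y z} → Adj G c y → ¬ Adj G c z → y ≢ z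
  centre-sides cy ¬cz refl = ¬cz cy

  firsts seconds : List Pair → List (Fin n)
  firsts  = map proj₁
  seconds = map proj₂

  module _ {Ps : List Pair} (anchoredPs : All Anchored Ps) where
    open Anchored

    centre-avoids : Avoids c Ps
    centre-avoids = All.map (λ a → (λ c≡y → Adj-irrefl G (subst (Adj G c) (sym c≡y) (centre-y a))) , z≢c a ∘ sym)
                            anchoredPs

    neighbour-avoids : ∀ {y} → Adj G c y → y ∉ firsts Ps → Avoids y Ps
    neighbour-avoids cy y∉ = All.tabulate λ {p} p∈ →
      (λ y≡ → y∉ (subst (_∈ firsts Ps) (sym y≡) (∈-map⁺ proj₁ p∈))) ,
      centre-sides cy (¬centre-z (All.lookup anchoredPs p∈))

    nonneighbour-avoids : ∀ {z} → ¬ Adj G c z → z ∉ seconds Ps → Avoids z Ps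
    nonneighbour-avoids ¬cz z∉ = All.tabulate λ {p} p∈ →
      (λ z≡ → centre-sides (centre-y (All.lookup anchoredPs p∈)) ¬cz (sym z≡)) ,
      (λ z≡ → z∉ (subst (_∈ seconds Ps) (sym z≡) (∈-map⁺ proj₂ p∈)))

  extend-disjoint : ∀ {Ps y z} → All Anchored Ps → Disjoint Ps → Anchored (y , z) →
                    y ∉ firsts Ps → z ∉ seconds Ps → Disjoint ((y , z) ∷ Ps)
  extend-disjoint anchoredPs disjoint a y∉ z∉ =
    centre-sides (centre-y a) (¬centre-z a) , neighbour-avoids anchoredPs (centre-y a) y∉ ,
    nonneighbour-avoids anchoredPs (¬centre-z a) z∉ , disjoint
    where open Anchored

  anchoredPairs : Connected G → 2 ≤ n → ∀ j → j < Subset.∣ nbhd ∣ → j < Subset.∣ ∁ nbhd ∣ →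
                  Σ (List Pair) λ Ps → All Anchored Ps × Disjoint Ps × length Ps ≡ j
  anchoredPairs conn 2≤n zero    _     _    = [] , [] , tt , refl
  anchoredPairs conn 2≤n (suc j) j<deg j<co
    with anchoredPairs conn 2≤n j (<-trans (n<1+n j) j<deg) (<-trans (n<1+n j) j<co)
  ... | Ps , anchoredPs , disjoint , refl
    with pigeonhole (∁ nbhd) (c ∷ seconds Ps) (subst (λ l → suc l < _) (sym (length-map proj₂ Ps)) j<co)
  ... | z , z∈ , z∉ with neighbour G conn 2≤n z
  ... | s , zs
    with pigeonhole nbhd (s ∷ firsts Ps) (subst (λ l → suc l < _) (sym (length-map proj₁ Ps)) j<deg)
  ... | y , y∈ , y∉ =
    (y , z) ∷ Ps , yz ∷ anchoredPs , extend-disjoint anchoredPs disjoint yz (y∉ ∘ there) (z∉ ∘ there) , refl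
    where
    yz : Anchored (y , z)
    yz = anchored (∈nbhd⇒Adj y∈) (∈∁nbhd⇒¬Adj z∈) (z∉ ∘ here) (s , zs , λ s≡y → y∉ (here (sym s≡y)))

  -- Inside a disjoint list Qs in which every mate of c is a non-neighbour of c
  -- adjacent to no non-neighbour of c, each anchored pair is well merged:
  -- y is dominated and z is split off by c, and z is dominated by its escape.
  anchoredWellMerged : ∀ {Qs} → Disjoint Qs →
    (∀ w → Mate Qs c w → ¬ Adj G c w × ∀ z → ¬ Adj G c z → ¬ Adj G z w) →
    ∀ {y z} → (y , z) ∈ Qs → Anchored (y , z) → WellMerged G Qs y z
  anchoredWellMerged {Qs} disjoint centreMates {y} yz∈ (anchored cy ¬cz _ (s , zs , s≢y)) = record
    { dominated-a = c , Adj-sym G cy , c∉mates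
    ; dominated-b = s , zs , λ zs-mate → s≢y (mate-unique disjoint zs-mate (inj₂ yz∈))
    ; split       = inj₁ (c , Adj-sym G cy , c∉mates , ¬cz ∘ Adj-sym G ,
                          λ w cw-mate → proj₂ (centreMates w cw-mate) _ ¬cz)
    }
    where
    c∉mates : ¬ Mate Qs y c
    c∉mates yc-mate = proj₁ (centreMates y (mate-sym yc-mate)) cy

  addAnchored : ∀ {Ps y z} → All Anchored Ps → Disjoint Ps → Anchored (y , z) →
                y ∉ firsts Ps → z ∉ seconds Ps →
                let Qs = (y , z) ∷ Ps in
                Disjoint Qs × (∀ {a b} → (a , b) ∈ Qs → WellMerged G Qs a b)
  addAnchored {Ps} {y} {z} anchoredPs disjoint yz y∉ z∉ =
    disjoint′ , λ ab∈ → anchoredWellMerged disjoint′ centreUnmated ab∈ (All.lookup (yz ∷ anchoredPs) ab∈)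
    where
    disjoint′ : Disjoint ((y , z) ∷ Ps)
    disjoint′ = extend-disjoint anchoredPs disjoint yz y∉ z∉
    centreUnmated : ∀ w → Mate ((y , z) ∷ Ps) c w → ¬ Adj G c w × ∀ z → ¬ Adj G c z → ¬ Adj G z w
    centreUnmated w mate = ⊥-elim (avoids⇒unmated (centre-avoids (yz ∷ anchoredPs)) mate)

  addPendant : ∀ {Ps y₁ z₁ yₖ zₖ} → All Anchored Ps → Disjoint Ps → (y₁ , z₁) ∈ Ps →
               Adj G c yₖ → yₖ ∉ firsts Ps → ¬ Adj G c zₖ → zₖ ≢ c → zₖ ∉ seconds Ps →
               Adj G zₖ yₖ → (∀ s → Adj G zₖ s → s ≡ yₖ) →
               let Qs = (c , zₖ) ∷ Ps in
               Disjoint Qs × (∀ {a b} → (a , b) ∈ Qs → WellMerged G Qs a b)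
  addPendant {Ps} {y₁} {z₁} {yₖ} {zₖ} anchoredPs disjoint y₁z₁∈ cyₖ yₖ∉ ¬czₖ zₖ≢c zₖ∉ zₖyₖ pendant =
    disjoint′ , wellMerged
    where
    open Anchored
    Qs : List Pair
    Qs = (c , zₖ) ∷ Ps

    disjoint′ : Disjoint Qs
    disjoint′ = zₖ≢c ∘ sym , centre-avoids anchoredPs , nonneighbour-avoids anchoredPs ¬czₖ zₖ∉ , disjoint

    yₖ-avoids : Avoids yₖ Qs
    yₖ-avoids = ((λ yₖ≡c → Adj-irrefl G (subst (Adj G c) yₖ≡c cyₖ)) , centre-sides cyₖ ¬czₖ)
                ∷ neighbour-avoids anchoredPs cyₖ yₖ∉

    yₖ-unmated : ∀ {v} → ¬ Mate Qs v yₖ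
    yₖ-unmated = avoids⇒unmated yₖ-avoids ∘ mate-sym

    c-mate : ∀ {w} → Mate Qs c w → w ≡ zₖ
    c-mate mate = mate-unique disjoint′ mate (inj₁ (here refl))

    -- the only mate of c is zₖ, which no non-neighbour of c touches
    centreMates : ∀ w → Mate Qs c w → ¬ Adj G c w × ∀ z → ¬ Adj G c z → ¬ Adj G z w
    centreMates w mate rewrite c-mate mate =
      ¬czₖ , λ z ¬cz zzₖ → ¬cz (subst (Adj G c) (sym (pendant z (Adj-sym G zzₖ))) cyₖ)

    cy₁ : Adj G c y₁
    cy₁ = centre-y (All.lookup anchoredPs y₁z₁∈)

    y₁-splits : Splits G Qs c zₖ
    y₁-splits =
      y₁ , cy₁ , (λ mate → centre-sides cy₁ ¬czₖ (c-mate mate)) ,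
      (λ zₖy₁ → yₖ∉ (subst (_∈ firsts Ps) (pendant y₁ zₖy₁) (∈-map⁺ proj₁ y₁z₁∈))) ,
      (λ y mate zₖy → yₖ-unmated (subst (Mate Qs y₁) (pendant y zₖy) mate))

    wellMerged : ∀ {a b} → (a , b) ∈ Qs → WellMerged G Qs a b
    wellMerged (here refl) = record
      { dominated-a = yₖ , cyₖ , yₖ-unmated
      ; dominated-b = yₖ , zₖyₖ , yₖ-unmated
      ; split       = inj₁ y₁-splits
      }
    wellMerged (there ab∈) = anchoredWellMerged disjoint′ centreMates (there ab∈) (All.lookup anchoredPs ab∈)

  escapeOrPendant : ∀ z y → (∃ λ s → Adj G z s × s ≢ y) ⊎ (∀ s → Adj G z s → s ≡ y)
  escapeOrPendant z y with Fin.any? (λ s → Adj? G z s ×-dec ¬? (s Fin.≟ y))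
  ... | yes escape = inj₁ escape
  ... | no ¬escape = inj₂ λ s zs → decidable-stable (s Fin.≟ y) λ s≢y → ¬escape (s , zs , s≢y)

  wellMergedPairs : Connected G → 2 ≤ n → ∀ k → 2 ≤ k →
                    k ≤ Subset.∣ nbhd ∣ → suc k ≤ Subset.∣ ∁ nbhd ∣ →
                    Σ (List Pair) λ Qs → Disjoint Qs × length Qs ≡ k ×
                      (∀ {a b} → (a , b) ∈ Qs → WellMerged G Qs a b)
  wellMergedPairs conn 2≤n (suc (suc k′)) _ k≤deg k<co
    with anchoredPairs conn 2≤n (suc k′) k≤deg (<-trans (n<1+n _) k<co)
  ... | [] , _ , _ , ()
  ... | Ps@(_ ∷ _) , anchoredPs , disjoint , len
    with pigeonhole nbhd (firsts Ps) (subst (_< Subset.∣ nbhd ∣) (sym (trans (length-map proj₁ Ps) len)) k≤deg)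
       | pigeonhole (∁ nbhd) (c ∷ seconds Ps)
                    (subst (λ l → suc l < Subset.∣ ∁ nbhd ∣) (sym (trans (length-map proj₂ Ps) len)) k<co)
  ... | yₖ , yₖ∈ , yₖ∉ | zₖ , zₖ∈ , zₖ∉ = complete (escapeOrPendant zₖ yₖ)
    where
    cyₖ : Adj G c yₖ
    cyₖ = ∈nbhd⇒Adj yₖ∈
    ¬czₖ : ¬ Adj G c zₖ
    ¬czₖ = ∈∁nbhd⇒¬Adj zₖ∈

    complete : (∃ λ s → Adj G zₖ s × s ≢ yₖ) ⊎ (∀ s → Adj G zₖ s → s ≡ yₖ) →
               Σ (List Pair) λ Qs → Disjoint Qs × length Qs ≡ suc (suc k′) ×
                 (∀ {a b} → (a , b) ∈ Qs → WellMerged G Qs a b)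
    complete (inj₁ escape)
      with addAnchored anchoredPs disjoint (anchored cyₖ ¬czₖ (zₖ∉ ∘ here) escape) yₖ∉ (zₖ∉ ∘ there)
    ... | disjoint′ , wellMerged = _ , disjoint′ , cong suc len , wellMerged
    complete (inj₂ pendant) with neighbour G conn 2≤n zₖ
    ... | x , zₖx
      with addPendant anchoredPs disjoint (here refl) cyₖ yₖ∉ ¬czₖ (zₖ∉ ∘ here) (zₖ∉ ∘ there)
                      (subst (Adj G zₖ) (pendant x zₖx) zₖx) pendant
    ...   | disjoint′ , wellMerged = _ , disjoint′ , cong suc len , wellMerged
  wellMergedPairs _ _ (suc zero) (s≤s ()) _ _

  resDomPartition : Connected G → 2 ≤ n → ∀ k → 2 ≤ k →
                    k ≤ Subset.∣ nbhd ∣ → suc k ≤ Subset.∣ ∁ nbhd ∣ →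
                    Σ (Fin n → Fin (n ∸ k)) (IsResDomPartition G (n ∸ k))
  resDomPartition conn 2≤n k 2≤k k≤deg k<co with wellMergedPairs conn 2≤n k 2≤k k≤deg k<co
  ... | Qs , disjoint , refl , wellMerged =
    mergedPartition G conn 2≤n Qs disjoint (n ∸ length Qs) (sym (m+[n∸m]≡n length≤n)) wellMerged
    where
    length≤n : length Qs ≤ n
    length≤n = ≤-trans (n≤1+n _) (≤-trans k<co (∣p∣≤n (∁ nbhd)))

room : ∀ {n k d} → k + 1 ≤ n → d ≤ n ∸ k ∸ 1 → suc k ≤ n ∸ d
room {n} {k} {d} k+1≤n d≤ =
  subst (_≤ n ∸ d) (+-comm k 1)
    (m+n≤o⇒m≤o∸n (k + 1) (subst (_≤ n) (+-comm d (k + 1))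
      (m≤o∸n⇒m+n≤o d k+1≤n (subst (d ≤_) (∸-+-assoc n k 1) d≤))))

mainTheorem18 : (k n : ℕ) → 2 ≤ k → (G : Graph n) → Connected G →
    (u : Fin n) → (d : ℕ) → degree G u ≡ d →
    2 * k + 1 ≤ n → k ≤ d → d ≤ n ∸ k ∸ 1 →
    EtaP≤ G (n ∸ k)
mainTheorem18 k n 2≤k G conn u d deg 2k+1≤n k≤d d≤ =
  n ∸ k , ≤-refl , resDomPartition conn 2≤n k 2≤k (subst (k ≤_) (sym deg) k≤d) k<co
  where
  open Anchoring G u
  open import Data.Fin.Subset as Subset using (∁)
  open import Data.Fin.Subset.Properties using (∣∁p∣≡n∸∣p∣)

  k+1≤n : k + 1 ≤ n
  k+1≤n = ≤-trans (+-monoˡ-≤ 1 (m≤m+n k (k + 0))) 2k+1≤n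
  2≤n : 2 ≤ n
  2≤n = ≤-trans 2≤k (m+n≤o⇒m≤o k k+1≤n)
  k<co : suc k ≤ Subset.∣ ∁ nbhd ∣
  k<co = subst (suc k ≤_) (sym (trans (∣∁p∣≡n∸∣p∣ nbhd) (cong (n ∸_) deg))) (room k+1≤n d≤)
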